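{- Let $V$ be a finite set with $n=|V|$, $d$ a nonnegative integer, and $f:2^V\to\{0,1,\dots,d\}$ a posimodular function with $f(\emptyset)=0$. Let $\mathcal{U}$ be the family of minimal unreachable sets of $f$, and define the Boolean function on variables $x=(x_v)_{v\in V}\in\{0,1\}^V$ $$\varphi_f(x)=\bigwedge_{U\in\mathcal{U}}\ \bigwedge_{s\in U}\Big(\bigvee_{u\in U\setminus\{s\}} x_u\ \vee\ \overline{x}_s\Big).$$ Then $|\{x\in\{0,1\}^V\mid \varphi_f(x)=1\}|\le \sum_{i=0}^{d}\binom{n}{i}$.
   Context: A set function $f:2^V\to\mathbb{R}$ is posimodular if $f(X)+f(Y)\ge f(X\setminus Y)+f(Y\setminus X)$ for all $X,Y\subseteq V$. A subset $X\subseteq V$ with $k=|X|$ is reachable (from $\emptyset$) if there is a chain $\emptyset=X_0\subsetneq X_1\subsetneq\cdots\subsetneq X_k=X$ with $f(X_i)>f(X_{i-1})$ for all $i=1,\dots,k$; otherwise it is unreachable. An unreachable set is minimal unreachable if every proper subset of it is reachable. $\overline{x}_s$ denotes the negation of $x_s$. -}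

module Defs where

open import Data.Nat using (ℕ; _+_; _≤_; _<_; suc)
open import Data.Nat.Combinatorics using (_C_)
open import Data.Fin using (Fin)
open import Data.Fin.Subset using (Subset; ⊥; ⁅_⁆; _∈_; _∉_; _⊂_; _∪_; _─_)
open import Data.List using (List; map; upTo; length)
open import Data.Nat.ListAction using (sum)
open import Data.List.Relation.Unary.All using (All)
open import Data.List.Relation.Unary.Unique.Propositional using (Unique)
open import Data.Product using (Σ; _×_; ∃)
open import Data.Sum using (_⊎_)
open import Relation.Binary.PropositionalEquality using (_≡_)
open import Relation.Nullary using (¬_)

Posimodular : {n : ℕ} → (Subset n → ℕ) → Set
Posimodular f = ∀ X Y → f (X ─ Y) + f (Y ─ X) ≤ f X + f Y

-- Reachable f X : there is a chain ∅ = X₀ ⊊ X₁ ⊊ ⋯ ⊊ X_k = X, k = |X|,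
-- with f strictly increasing.  Since k = |X|, each step adds exactly one
-- element; the chain is built up one step at a time.
data Reachable {n : ℕ} (f : Subset n → ℕ) : Subset n → Set where
  base : Reachable f ⊥
  step : ∀ {X} (v : Fin n) → Reachable f X → v ∉ X →
         f X < f (X ∪ ⁅ v ⁆) → Reachable f (X ∪ ⁅ v ⁆)

MinimalUnreachable : {n : ℕ} → (Subset n → ℕ) → Subset n → Set
MinimalUnreachable f U = ¬ Reachable f U × (∀ W → W ⊂ U → Reachable f W)

-- An assignment x ∈ {0,1}^V is encoded as a Subset n: x_v = 1 iff v ∈ x.
-- φ_f(x) = 1 iff for every minimal unreachable U and every s ∈ U,
-- (∃ u ∈ U ∖ {s} with x_u = 1) ∨ x_s = 0.
φ : {n : ℕ} → (Subset n → ℕ) → Subset n → Set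
φ f x = ∀ U → MinimalUnreachable f U → ∀ s → s ∈ U →
        (∃ λ u → u ∈ U × ¬ (u ≡ s) × u ∈ x) ⊎ s ∉ x

binomSum : ℕ → ℕ → ℕ
binomSum n d = sum (map (n C_) (upTo (suc d)))

-- "|{x | φ_f(x)=1}| ≤ m": every duplicate-free list of satisfying
-- assignments has length at most m.
CountAtMost : {n : ℕ} → (Subset n → Set) → ℕ → Set
CountAtMost {n} P m = (xs : List (Subset n)) → Unique xs → All P xs → length xs ≤ m

-- A reachable set X satisfies |X| ≤ f(X) ≤ d, since f increases by at least one along
-- each step of its chain; so every set of size d + 1 is unreachable.  The satisfying
-- assignments of φ_f, viewed as subsets of V, shatter no unreachable set S: S contains
-- a minimal unreachable U, which is nonempty because ∅ is reachable, and for s ∈ U an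
-- assignment x with x ∩ S = {s} violates the clause of φ_f for (U, s).  The
-- Sauer–Shelah lemma then bounds their number by Σ_{i≤d} C(n,i).
module Submission where

open import Algebra.Properties.CommutativeSemigroup using (interchange)
open import Data.Bool.Properties using (∧-zeroʳ) renaming (_≟_ to _≟ᵇ_)
open import Data.Fin using (Fin; zero; suc)
open import Data.Fin.Properties using (any?)
open import Data.Fin.Subset
  using (Subset; Side; inside; outside; ⊥; ⁅_⁆; _∈_; _∉_; _⊆_; _⊂_; _∪_; _∩_; _-_; ∣_∣)
open import Data.Fin.Subset.Induction using (⊂-wellFounded; Acc; acc)
open import Data.Fin.Subset.Properties
  using ( _∈?_; _⊂?_; anySubset?; nonempty?; Empty-unique; ∣⊥∣≡0; x∈⁅x⁆; x∈⁅y⁆⇒x≡y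
        ; x∈p∩q⁺; x∈p∩q⁻; ∩-zeroʳ; q⊆p∪q; ∪-identityʳ; p─⊥≡p; x∈p⇒p-x⊂p; ⊆-trans; p⊂q⇒p⊆q)
open import Data.List using (List; []; _∷_; [_]; _++_; length; map; upTo; filter)
open import Data.List.Membership.Propositional using () renaming (_∈_ to _∈ₗ_)
open import Data.List.Membership.Propositional.Properties using (∈-filter⁻; ∈-++⁻)
open import Data.List.Properties using (upTo-∷ʳ; map-++; length-++)
open import Data.List.Relation.Unary.All as All using (All; _∷_)
open import Data.List.Relation.Unary.AllPairs using ([]; _∷_)
open import Data.List.Relation.Unary.Any as Any using ()
open import Data.List.Relation.Unary.Unique.Propositional using (Unique)
import Data.List.Relation.Unary.Unique.Propositional.Properties as Unique
open import Data.Nat using (ℕ; zero; suc; _+_; _≤_; _<_; _<?_; z≤n; s≤s)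
open import Data.Nat.Combinatorics using (_C_; nCk+nC[k+1]≡[n+1]C[k+1])
open import Data.Nat.ListAction using (sum)
open import Data.Nat.ListAction.Properties using (sum-++)
open import Data.Nat.Properties
  using ( ≤-trans; 1+n≰n; m≤m+n; +-mono-≤; +-identityʳ; +-comm; +-assoc; +-suc
        ; +-commutativeSemigroup; module ≤-Reasoning)
open import Data.Product as Product using (∃; _×_; _,_; proj₁; proj₂)
open import Data.Sum as Sum using (_⊎_; inj₁; inj₂; [_,_]′)
open import Data.Vec using ([]; _∷_; here; there)
open import Data.Vec.Properties using (≡-dec)
open import Function using (_∘_)
open import Relation.Binary.Definitions using (DecidableEquality)
open import Relation.Binary.PropositionalEquality
  using (_≡_; refl; sym; trans; cong; cong₂; subst; module ≡-Reasoning)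
open import Relation.Nullary using (¬_; Dec; yes; no; contradiction)
open import Relation.Nullary.Decidable using (_×-dec_; ¬?; decidable-stable; map′)
open import Relation.Unary using (Pred; Decidable)
open import Relation.Unary.Properties using (∁?)

open import Defs

private
  variable
    n : ℕ

x∉p-x : (x : Fin n) (p : Subset n) → x ∉ p - x
x∉p-x (suc x) (_ ∷ p) (there x∈p-x) = x∉p-x x p x∈p-x

x∈p∪⁅x⁆ : (x : Fin n) (p : Subset n) → x ∈ p ∪ ⁅ x ⁆
x∈p∪⁅x⁆ x p = q⊆p∪q p ⁅ x ⁆ (x∈⁅x⁆ x)

x∈p⇒p-x∪⁅x⁆≡p : {x : Fin n} {p : Subset n} → x ∈ p → (p - x) ∪ ⁅ x ⁆ ≡ p
x∈p⇒p-x∪⁅x⁆≡p {p = inside  ∷ p} here        = cong (inside ∷_) (trans (cong (_∪ ⊥) (p─⊥≡p p)) (∪-identityʳ p))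
x∈p⇒p-x∪⁅x⁆≡p {p = inside  ∷ p} (there x∈p) = cong (inside ∷_)  (x∈p⇒p-x∪⁅x⁆≡p x∈p)
x∈p⇒p-x∪⁅x⁆≡p {p = outside ∷ p} (there x∈p) = cong (outside ∷_) (x∈p⇒p-x∪⁅x⁆≡p x∈p)

x∉p⇒p∪⁅x⁆-x≡p : {x : Fin n} {p : Subset n} → x ∉ p → (p ∪ ⁅ x ⁆) - x ≡ p
x∉p⇒p∪⁅x⁆-x≡p {x = zero}  {p = inside  ∷ p} x∉p = contradiction here x∉p
x∉p⇒p∪⁅x⁆-x≡p {x = zero}  {p = outside ∷ p} _   = cong (outside ∷_) (trans (p─⊥≡p (p ∪ ⊥)) (∪-identityʳ p))
x∉p⇒p∪⁅x⁆-x≡p {x = suc x} {p = inside  ∷ p} x∉p = cong (inside ∷_)  (x∉p⇒p∪⁅x⁆-x≡p (x∉p ∘ there))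
x∉p⇒p∪⁅x⁆-x≡p {x = suc x} {p = outside ∷ p} x∉p = cong (outside ∷_) (x∉p⇒p∪⁅x⁆-x≡p (x∉p ∘ there))

x∉p⇒∣p∪⁅x⁆∣≡1+∣p∣ : {x : Fin n} {p : Subset n} → x ∉ p → ∣ p ∪ ⁅ x ⁆ ∣ ≡ suc ∣ p ∣
x∉p⇒∣p∪⁅x⁆∣≡1+∣p∣ {x = zero}  {p = inside  ∷ p} x∉p = contradiction here x∉p
x∉p⇒∣p∪⁅x⁆∣≡1+∣p∣ {x = zero}  {p = outside ∷ p} _   = cong (suc ∘ ∣_∣) (∪-identityʳ p)
x∉p⇒∣p∪⁅x⁆∣≡1+∣p∣ {x = suc x} {p = inside  ∷ p} x∉p = cong suc (x∉p⇒∣p∪⁅x⁆∣≡1+∣p∣ (x∉p ∘ there))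
x∉p⇒∣p∪⁅x⁆∣≡1+∣p∣ {x = suc x} {p = outside ∷ p} x∉p = x∉p⇒∣p∪⁅x⁆∣≡1+∣p∣ (x∉p ∘ there)

⊆-minimal : ∀ {ℓ} {P : Pred (Subset n) ℓ} → Decidable P → ∀ {U} → P U →
            ∃ λ W → W ⊆ U × P W × (∀ V → V ⊂ W → ¬ P V)
⊆-minimal {P = P} P? = go (⊂-wellFounded _)
  where
  go : ∀ {U} → Acc _⊂_ U → P U → ∃ λ W → W ⊆ U × P W × (∀ V → V ⊂ W → ¬ P V)
  go {U} (acc rec) PU with anySubset? (λ V → (V ⊂? U) ×-dec P? V)
  ... | no ∄V = U , (λ x∈U → x∈U) , PU , λ V V⊂U PV → ∄V (V , V⊂U , PV)
  ... | yes (V , V⊂U , PV) with go (rec V⊂U) PV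
  ...   | W , W⊆V , rest = W , ⊆-trans W⊆V (p⊂q⇒p⊆q V⊂U) , rest

module _ {n : ℕ} (f : Subset n → ℕ) where

  LastStep : Subset n → Fin n → Set
  LastStep X v = v ∈ X × Reachable f (X - v) × f (X - v) < f X

  LastStep⇒Reachable : ∀ {X v} → LastStep X v → Reachable f X
  LastStep⇒Reachable {X} {v} (v∈X , r , lt) = subst (Reachable f) (x∈p⇒p-x∪⁅x⁆≡p v∈X)
    (step v r (x∉p-x v X) (subst (λ Y → f (X - v) < f Y) (sym (x∈p⇒p-x∪⁅x⁆≡p v∈X)) lt))

  Reachable⇒LastStep : ∀ {X} → Reachable f X → X ≡ ⊥ ⊎ ∃ (LastStep X)
  Reachable⇒LastStep base = inj₁ refl
  Reachable⇒LastStep (step {Y} v r v∉Y lt) = inj₂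
    (v , x∈p∪⁅x⁆ v Y , subst (Reachable f) (sym Y≡) r , subst (λ Z → f Z < f (Y ∪ ⁅ v ⁆)) (sym Y≡) lt)
    where Y≡ = x∉p⇒p∪⁅x⁆-x≡p v∉Y

  Reachable⇒∣X∣≤f : ∀ {X} → Reachable f X → ∣ X ∣ ≤ f X
  Reachable⇒∣X∣≤f base = subst (_≤ f ⊥) (sym (∣⊥∣≡0 n)) z≤n
  Reachable⇒∣X∣≤f (step {Y} v r v∉Y lt) =
    subst (_≤ f (Y ∪ ⁅ v ⁆)) (sym (x∉p⇒∣p∪⁅x⁆∣≡1+∣p∣ v∉Y)) (≤-trans (s≤s (Reachable⇒∣X∣≤f r)) lt)

  reachable? : Decidable (Reachable f)
  reachable? X = go (⊂-wellFounded X)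
    where
    go : ∀ {X} → Acc _⊂_ X → Dec (Reachable f X)
    lastStep? : ∀ {X} → Acc _⊂_ X → ∀ v → Dec (LastStep X v)
    go {X} (acc rec) with ≡-dec _≟ᵇ_ X ⊥ | any? (lastStep? (acc rec))
    ... | yes refl | _ = yes base
    ... | no X≢⊥ | yes (v , last) = yes (LastStep⇒Reachable last)
    ... | no X≢⊥ | no ∄last = no λ r → [ X≢⊥ , ∄last ]′ (Reachable⇒LastStep r)
    lastStep? {X} (acc rec) v with v ∈? X
    ... | no v∉X = no (v∉X ∘ proj₁)
    ... | yes v∈X = map′ (v∈X ,_) proj₂ (go (rec (x∈p⇒p-x⊂p v∈X)) ×-dec (f (X - v) <? f X))

  ¬Reachable⇒∃MinimalUnreachable⊆ : ∀ {U} → ¬ Reachable f U →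
                                    ∃ λ W → W ⊆ U × MinimalUnreachable f W
  ¬Reachable⇒∃MinimalUnreachable⊆ ¬rU with ⊆-minimal (¬? ∘ reachable?) ¬rU
  ... | W , W⊆U , ¬rW , minimal =
    W , W⊆U , ¬rW , λ V V⊂W → decidable-stable (reachable? V) (minimal V V⊂W)

length-filter+length-filter-∁ : ∀ {a p} {A : Set a} {P : Pred A p} (P? : Decidable P) (xs : List A) →
                                length (filter P? xs) + length (filter (∁? P?) xs) ≡ length xs
length-filter+length-filter-∁ P? [] = refl
length-filter+length-filter-∁ P? (x ∷ xs) with P? x
... | yes _ = cong suc (length-filter+length-filter-∁ P? xs)
... | no _  = trans (+-suc _ _) (cong suc (length-filter+length-filter-∁ P? xs))

module ListSetOps {a} {A : Set a} (_≟_ : DecidableEquality A) where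

  open import Data.List.Membership.DecPropositional _≟_
    using () renaming (_∈?_ to _∈ₗ?_; _∉?_ to _∉ₗ?_)

  infixl 6 _∪ₗ_
  infixl 7 _∩ₗ_

  _∪ₗ_ : List A → List A → List A
  xs ∪ₗ ys = xs ++ filter (_∉ₗ? xs) ys

  _∩ₗ_ : List A → List A → List A
  xs ∩ₗ ys = filter (_∈ₗ? xs) ys

  ∈-∪ₗ⁻ : ∀ {z} xs ys → z ∈ₗ xs ∪ₗ ys → z ∈ₗ xs ⊎ z ∈ₗ ys
  ∈-∪ₗ⁻ xs ys z∈ = Sum.map₂ (proj₁ ∘ ∈-filter⁻ (_∉ₗ? xs)) (∈-++⁻ xs z∈)

  ∈-∩ₗ⁻ : ∀ {z} xs ys → z ∈ₗ xs ∩ₗ ys → z ∈ₗ xs × z ∈ₗ ys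
  ∈-∩ₗ⁻ xs ys z∈ = Product.swap (∈-filter⁻ (_∈ₗ? xs) z∈)

  ∪ₗ⁺ : ∀ {xs ys} → Unique xs → Unique ys → Unique (xs ∪ₗ ys)
  ∪ₗ⁺ {xs} {ys} xs! ys! = Unique.++⁺ xs! (Unique.filter⁺ (_∉ₗ? xs) ys!)
    λ (z∈xs , z∈ys∖xs) → proj₂ (∈-filter⁻ (_∉ₗ? xs) {xs = ys} z∈ys∖xs) z∈xs

  ∩ₗ⁺ : ∀ xs {ys} → Unique ys → Unique (xs ∩ₗ ys)
  ∩ₗ⁺ xs = Unique.filter⁺ (_∈ₗ? xs)

  length-∪ₗ+length-∩ₗ : ∀ xs ys → length (xs ∪ₗ ys) + length (xs ∩ₗ ys) ≡ length xs + length ys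
  length-∪ₗ+length-∩ₗ xs ys = begin
    length (xs ++ ys∖xs) + length ys∩xs       ≡⟨ cong (_+ length ys∩xs) (length-++ xs) ⟩
    length xs + length ys∖xs + length ys∩xs   ≡⟨ +-assoc (length xs) _ _ ⟩
    length xs + (length ys∖xs + length ys∩xs) ≡⟨ cong (length xs +_) (+-comm (length ys∖xs) _) ⟩
    length xs + (length ys∩xs + length ys∖xs)
      ≡⟨ cong (length xs +_) (length-filter+length-filter-∁ (_∈ₗ? xs) ys) ⟩
    length xs + length ys                     ∎
    where
    open ≡-Reasoning
    ys∖xs = filter (_∉ₗ? xs) ys
    ys∩xs = filter (_∈ₗ? xs) ys

binomPrefix : ℕ → ℕ → ℕ
binomPrefix n k = sum (map (n C_) (upTo k))

binomPrefix-suc : ∀ n k → binomPrefix n (suc k) ≡ binomPrefix n k + n C k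
binomPrefix-suc n k = begin
  sum (map (n C_) (upTo (suc k)))            ≡⟨ cong (sum ∘ map (n C_)) (upTo-∷ʳ k) ⟨
  sum (map (n C_) (upTo k ++ [ k ]))         ≡⟨ cong sum (map-++ (n C_) (upTo k) [ k ]) ⟩
  sum (map (n C_) (upTo k) ++ [ n C k ])     ≡⟨ sum-++ (map (n C_) (upTo k)) [ n C k ] ⟩
  binomPrefix n k + (n C k + 0)              ≡⟨ cong (binomPrefix n k +_) (+-identityʳ (n C k)) ⟩
  binomPrefix n k + n C k                    ∎
  where open ≡-Reasoning

binomPrefix-pascal : ∀ n k → binomPrefix (suc n) (suc k) ≡ binomPrefix n (suc k) + binomPrefix n k
binomPrefix-pascal n zero = refl
binomPrefix-pascal n (suc k) = begin
  binomPrefix (suc n) (suc (suc k))                          ≡⟨ binomPrefix-suc (suc n) (suc k) ⟩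
  binomPrefix (suc n) (suc k) + suc n C suc k
    ≡⟨ cong₂ _+_ (binomPrefix-pascal n k) (sym (nCk+nC[k+1]≡[n+1]C[k+1] n k)) ⟩
  (binomPrefix n (suc k) + binomPrefix n k) + (n C k + n C suc k)
    ≡⟨ cong ((binomPrefix n (suc k) + binomPrefix n k) +_) (+-comm (n C k) (n C suc k)) ⟩
  (binomPrefix n (suc k) + binomPrefix n k) + (n C suc k + n C k)
    ≡⟨ interchange +-commutativeSemigroup (binomPrefix n (suc k)) (binomPrefix n k) (n C suc k) (n C k) ⟩
  (binomPrefix n (suc k) + n C suc k) + (binomPrefix n k + n C k)
    ≡⟨ cong₂ _+_ (binomPrefix-suc n (suc k)) (binomPrefix-suc n k) ⟨
  binomPrefix n (suc (suc k)) + binomPrefix n (suc k)        ∎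
  where open ≡-Reasoning

1≤binomPrefix-suc : ∀ n k → 1 ≤ binomPrefix n (suc k)
1≤binomPrefix-suc n k = m≤m+n 1 _

Shatters : List (Subset n) → Subset n → Set
Shatters xs S = ∀ T → ∃ λ x → x ∈ₗ xs × x ∩ S ≡ T ∩ S

Shatters-outside∷ : ∀ {xs : List (Subset (suc n))} {ys S} →
                    (∀ {y} → y ∈ₗ ys → ∃ λ b → (b ∷ y) ∈ₗ xs) →
                    Shatters ys S → Shatters xs (outside ∷ S)
Shatters-outside∷ lift shatters (t ∷ T) with shatters T
... | y , y∈ys , trace with lift y∈ys
...   | b , by∈xs = b ∷ y , by∈xs , cong₂ _∷_ (trans (∧-zeroʳ b) (sym (∧-zeroʳ t))) trace

Shatters-inside∷ : ∀ {xs : List (Subset (suc n))} {ys S} →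
                   (∀ {y} → y ∈ₗ ys → ∀ b → (b ∷ y) ∈ₗ xs) →
                   Shatters ys S → Shatters xs (inside ∷ S)
Shatters-inside∷ lift shatters (t ∷ T) with shatters T
... | y , y∈ys , trace = t ∷ y , lift y∈ys t , cong (_ ∷_) trace

tails : Side → List (Subset (suc n)) → List (Subset n)
tails b [] = []
tails b ((c ∷ y) ∷ xs) with b ≟ᵇ c
... | yes _ = y ∷ tails b xs
... | no _  = tails b xs

∈-tails⁻ : ∀ {b y} (xs : List (Subset (suc n))) → y ∈ₗ tails b xs → (b ∷ y) ∈ₗ xs
∈-tails⁻ {b = b} ((c ∷ z) ∷ xs) y∈ with b ≟ᵇ c | y∈
... | yes refl | Any.here refl = Any.here refl
... | yes refl | Any.there y∈′ = Any.there (∈-tails⁻ xs y∈′)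
... | no _     | y∈′ = Any.there (∈-tails⁻ xs y∈′)

tails⁺ : ∀ b {xs : List (Subset (suc n))} → Unique xs → Unique (tails b xs)
tails⁺ b [] = []
tails⁺ b {(c ∷ y) ∷ xs} (y∉xs ∷ unique) with b ≟ᵇ c
... | yes refl =
  All.tabulate (λ z∈ y≡z → All.lookup y∉xs (∈-tails⁻ xs z∈) (cong (b ∷_) y≡z)) ∷ tails⁺ b unique
... | no _     = tails⁺ b unique

length-tails : (xs : List (Subset (suc n))) →
               length (tails outside xs) + length (tails inside xs) ≡ length xs
length-tails [] = refl
length-tails ((outside ∷ y) ∷ xs) = cong suc (length-tails xs)
length-tails ((inside  ∷ y) ∷ xs) = trans (+-suc _ _) (cong suc (length-tails xs))

Unique⇒length≤1 : (xs : List (Subset 0)) → Unique xs → length xs ≤ 1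
Unique⇒length≤1 []            _               = z≤n
Unique⇒length≤1 ([] ∷ [])     _               = s≤s z≤n
Unique⇒length≤1 ([] ∷ [] ∷ _) ((≢[] ∷ _) ∷ _) = contradiction refl ≢[]

sauer-shelah : ∀ n k (xs : List (Subset n)) → Unique xs →
               (∀ S → ∣ S ∣ ≡ k → ¬ Shatters xs S) → length xs ≤ binomPrefix n k
sauer-shelah n zero [] _ _ = z≤n
sauer-shelah n zero (x ∷ _) _ ¬shatters = contradiction
  (λ T → x , Any.here refl , trans (∩-zeroʳ x) (sym (∩-zeroʳ T))) (¬shatters ⊥ (∣⊥∣≡0 n))
sauer-shelah zero (suc k) xs xs! _ = ≤-trans (Unique⇒length≤1 xs xs!) (1≤binomPrefix-suc 0 k)
-- Split the family by its first coordinate into A and B: a set shattered by A ∪ B stays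
-- shattered without the first coordinate, one shattered by A ∩ B stays shattered with it.
sauer-shelah (suc n) (suc k) xs xs! ¬shatters = begin
  length xs                                  ≡⟨ length-tails xs ⟨
  length A + length B                        ≡⟨ length-∪ₗ+length-∩ₗ A B ⟨
  length (A ∪ₗ B) + length (A ∩ₗ B)          ≤⟨ +-mono-≤ union-bound intersection-bound ⟩
  binomPrefix n (suc k) + binomPrefix n k    ≡⟨ binomPrefix-pascal n k ⟨
  binomPrefix (suc n) (suc k)                ∎
  where
  open ≤-Reasoning
  open ListSetOps {A = Subset n} (≡-dec _≟ᵇ_)
  A B : List (Subset n)
  A = tails outside xs
  B = tails inside xs
  union-bound : length (A ∪ₗ B) ≤ binomPrefix n (suc k)
  union-bound = sauer-shelah n (suc k) (A ∪ₗ B) (∪ₗ⁺ (tails⁺ outside xs!) (tails⁺ inside xs!))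
    λ S ∣S∣≡ → ¬shatters (outside ∷ S) ∣S∣≡ ∘ Shatters-outside∷ λ {y} y∈ →
      [ (λ y∈A → outside , ∈-tails⁻ xs y∈A) , (λ y∈B → inside , ∈-tails⁻ xs y∈B) ]′ (∈-∪ₗ⁻ A B y∈)
  intersection-bound : length (A ∩ₗ B) ≤ binomPrefix n k
  intersection-bound = sauer-shelah n k (A ∩ₗ B) (∩ₗ⁺ A (tails⁺ inside xs!))
    λ S ∣S∣≡ → ¬shatters (inside ∷ S) (cong suc ∣S∣≡) ∘ Shatters-inside∷ λ {y} y∈ → λ where
      outside → ∈-tails⁻ xs (proj₁ (∈-∩ₗ⁻ A B y∈))
      inside  → ∈-tails⁻ xs (proj₂ (∈-∩ₗ⁻ A B y∈))

∩-traceˡ : ∀ {x S : Subset n} {s u} → x ∩ S ≡ ⁅ s ⁆ ∩ S → u ∈ S → u ∈ x → u ≡ s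
∩-traceˡ {x = x} {S} {s} trace u∈S u∈x =
  x∈⁅y⁆⇒x≡y s (proj₁ (x∈p∩q⁻ ⁅ s ⁆ S (subst (_ ∈_) trace (x∈p∩q⁺ (u∈x , u∈S)))))

∩-traceʳ : ∀ {x S : Subset n} {s} → x ∩ S ≡ ⁅ s ⁆ ∩ S → s ∈ S → s ∈ x
∩-traceʳ {x = x} {S} {s} trace s∈S =
  proj₁ (x∈p∩q⁻ x S (subst (_ ∈_) (sym trace) (x∈p∩q⁺ (x∈⁅x⁆ s , s∈S))))

φ⇒¬Shatters-unreachable : ∀ {f : Subset n → ℕ} {xs S} →
                          All (φ f) xs → ¬ Reachable f S → ¬ Shatters xs S
φ⇒¬Shatters-unreachable {f = f} φxs ¬rS shatters with ¬Reachable⇒∃MinimalUnreachable⊆ f ¬rS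
... | U , U⊆S , minU with nonempty? U
...   | no U-empty = proj₁ minU (subst (Reachable f) (sym (Empty-unique U-empty)) base)
...   | yes (s , s∈U) with shatters ⁅ s ⁆
...     | x , x∈xs , trace with All.lookup φxs x∈xs U minU s s∈U
...       | inj₁ (u , u∈U , u≢s , u∈x) = u≢s (∩-traceˡ trace (U⊆S u∈U) u∈x)
...       | inj₂ s∉x = s∉x (∩-traceʳ trace (U⊆S s∈U))

lemma11 : (n d : ℕ) (f : Subset n → ℕ) →
          (∀ X → f X ≤ d) → Posimodular f → f ⊥ ≡ 0 →
          CountAtMost (φ f) (binomSum n d)
lemma11 n d f f≤d _ _ xs xs! φxs = sauer-shelah n (suc d) xs xs! λ S ∣S∣≡1+d →
  φ⇒¬Shatters-unreachable φxs λ rS →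
    1+n≰n (subst (_≤ d) ∣S∣≡1+d (≤-trans (Reachable⇒∣X∣≤f f rS) (f≤d S)))
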